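{- For every positive integer $k$ and every graph $G=(V,E)$, $$f_k(G) \geq \sum_{v \in V} \left\lceil \frac{\deg v}{2k} \right\rceil.$$
   Context: A $k$-radius sequence for $G$ is a finite sequence $x_1,\ldots,x_M$ of vertices of $G$ (repetitions allowed) such that for every edge $uv$ there are $i,j$ with $x_i=u$, $x_j=v$, $|i-j|\leq k$; $f_k(G)$ is the minimum length of such a sequence. -}

module Defs where

open import Data.Bool using (Bool; true; false)
open import Data.Nat using (ℕ; _+_; _*_; _∸_; _/_; _≤_; ∣_-_∣; NonZero)
open import Data.Fin using (Fin; toℕ)
open import Data.Vec using (Vec; allFin; countᵇ; map; sum)
open import Data.List using (List; length; lookup)
open import Data.Product using (∃₂; _×_)
open import Relation.Binary.PropositionalEquality using (_≡_)

record Graph (n : ℕ) : Set where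
  field
    adj    : Fin n → Fin n → Bool
    sym    : ∀ u v → adj u v ≡ adj v u
    irrefl : ∀ v → adj v v ≡ false

open Graph public

deg : ∀ {n} → Graph n → Fin n → ℕ
deg G v = countᵇ (adj G v) (allFin _)

⌈_/_⌉ : ℕ → (b : ℕ) → .{{NonZero b}} → ℕ
⌈ a / b ⌉ = (a + (b ∸ 1)) / b

ΣV : ∀ n → (Fin n → ℕ) → ℕ
ΣV n f = sum (map f (allFin n))

IsRadiusSeq : ∀ {n} → ℕ → Graph n → List (Fin n) → Set
IsRadiusSeq k G xs =
  ∀ u v → adj G u v ≡ true →
  ∃₂ λ (i j : Fin (length xs)) →
    lookup xs i ≡ u × lookup xs j ≡ v × ∣ toℕ i - toℕ j ∣ ≤ k

-- Each occurrence of a vertex v in a k-radius sequence can serve at most 2k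
-- edges at v, namely those to the vertices at the 2k positions within
-- distance k of it.  Hence deg v ≤ 2k · occ v, where occ v is the number of
-- occurrences of v, and summing ⌈deg v / 2k⌉ ≤ occ v over all vertices
-- bounds the left-hand side by the length of the sequence.
module Submission where

open import Defs hiding (sym)
open import Data.Bool using (Bool; true; false)
open import Data.Nat using (ℕ; zero; suc; _+_; _*_; _∸_; _≤_; _<_; z≤n; s≤s; s≤s⁻¹; ∣_-_∣; NonZero)
open import Data.Nat.Properties hiding (_≟_)
open import Data.Nat.DivMod using (m<n*o⇒m/o<n)
open import Data.Fin as Fin using (Fin; toℕ; fromℕ<; _≟_)
open import Data.Fin.Properties using (toℕ-fromℕ<; toℕ-injective)
open import Data.List using (List; []; _∷_; length; lookup)
open import Data.Product using (∃-syntax; _×_; _,_)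
open import Data.Vec as Vec using (tabulate; countᵇ)
open import Data.Vec.Properties using (tabulate-allFin)
open import Function using (id; _∘_)
open import Relation.Nullary using (does; contradiction)
open import Relation.Nullary.Decidable using (dec-true)
open import Relation.Binary using (tri<; tri≈; tri>)
open import Relation.Binary.PropositionalEquality
  using (_≡_; _≢_; refl; sym; trans; cong; cong₂; subst)
open import Algebra.Properties.Semiring.Sum +-*-semiring
  using (sum-syntax; ∑-comm; ∑-distrib-+; *-distribˡ-sum; sum-cong-≗)

∑-mono-≤ : ∀ {n} {f g : Fin n → ℕ} → (∀ i → f i ≤ g i) → ∑[ i < n ] f i ≤ ∑[ i < n ] g i
∑-mono-≤ {zero}  f≤g = z≤n
∑-mono-≤ {suc n} f≤g = +-mono-≤ (f≤g Fin.zero) (∑-mono-≤ (f≤g ∘ Fin.suc))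

∑-const : ∀ n c → ∑[ i < n ] c ≡ n * c
∑-const zero    c = refl
∑-const (suc n) c = cong (c +_) (∑-const n c)

term≤∑ : ∀ {n} (f : Fin n → ℕ) i → f i ≤ ∑[ j < n ] f j
term≤∑ f Fin.zero    = m≤m+n _ _
term≤∑ f (Fin.suc i) = ≤-trans (term≤∑ (f ∘ Fin.suc) i) (m≤n+m _ _)

𝟙 : Bool → ℕ
𝟙 true  = 1
𝟙 false = 0

sum-tabulate : ∀ {n} (f : Fin n → ℕ) → Vec.sum (tabulate f) ≡ ∑[ i < n ] f i
sum-tabulate {zero}  f = refl
sum-tabulate {suc n} f = cong (f Fin.zero +_) (sum-tabulate (f ∘ Fin.suc))

ΣV≡∑ : ∀ n (f : Fin n → ℕ) → ΣV n f ≡ ∑[ v < n ] f v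
ΣV≡∑ n f = trans (cong Vec.sum (sym (tabulate-allFin f))) (sum-tabulate f)

countᵇ-tabulate : ∀ {A : Set} {n} (p : A → Bool) (f : Fin n → A) →
  countᵇ p (tabulate f) ≡ ∑[ i < n ] 𝟙 (p (f i))
countᵇ-tabulate {n = zero}  p f = refl
countᵇ-tabulate {n = suc n} p f with p (f Fin.zero) | countᵇ-tabulate p (f ∘ Fin.suc)
... | true  | eq = cong suc eq
... | false | eq = eq

⌈m/n⌉≤o : ∀ m n o .{{_ : NonZero n}} → m ≤ n * o → ⌈ m / n ⌉ ≤ o
⌈m/n⌉≤o m n@(suc n-1) o m≤n*o = s≤s⁻¹ (m<n*o⇒m/o<n (begin-strict
  m + n-1    <⟨ +-monoʳ-< m (n<1+n n-1) ⟩
  m + n      ≤⟨ +-monoˡ-≤ n (≤-trans m≤n*o (≤-reflexive (*-comm n o))) ⟩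
  o * n + n  ≡⟨ +-comm (o * n) n ⟩
  suc o * n  ∎))
  where open ≤-Reasoning

-- For d ≥ a the truncated subtraction a ∸ suc d is 0, so position 0 may be
-- counted repeatedly; this only enlarges the window.
window : ℕ → (ℕ → ℕ) → ℕ → ℕ
window k f a = ∑[ d < k ] (f (a + suc (toℕ d)) + f (a ∸ suc (toℕ d)))

offset : ∀ {k} a b → a < b → ∣ a - b ∣ ≤ k → ∃[ d ] d < k × a + suc d ≡ b
offset zero    (suc b) _         b<k  = b , b<k , refl
offset (suc a) (suc b) (s≤s a<b) dist with offset a b a<b dist
... | d , d<k , a+1+d≡b = d , d<k , cong suc a+1+d≡b

offsets≤window : ∀ {k} f a {d} (d<k : d < k) → f (a + suc d) + f (a ∸ suc d) ≤ window k f a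
offsets≤window f a d<k =
  subst (λ d → f (a + suc d) + f (a ∸ suc d) ≤ _) (toℕ-fromℕ< d<k) (term≤∑ _ (fromℕ< d<k))

near⇒≤window : ∀ {k} f {a b} → a ≢ b → ∣ a - b ∣ ≤ k → f b ≤ window k f a
near⇒≤window f {a} {b} a≢b dist with <-cmp a b
... | tri< a<b _ _ with offset a b a<b dist
...   | d , d<k , refl = ≤-trans (m≤m+n _ _) (offsets≤window f a d<k)
near⇒≤window f a≢b dist | tri≈ _ a≡b _ = contradiction a≡b a≢b
near⇒≤window {k} f {a} {b} a≢b dist | tri> _ _ b<a
  with offset b a b<a (subst (_≤ k) (∣-∣-comm a b) dist)
... | d , d<k , refl = subst (λ x → f x ≤ window k f (b + suc d)) (m+n∸n≡m b (suc d))
                         (≤-trans (m≤n+m _ _) (offsets≤window f (b + suc d) d<k))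

occursAt : ∀ {n} → List (Fin n) → ℕ → Fin n → ℕ
occursAt []       p       u = 0
occursAt (x ∷ xs) zero    u = 𝟙 (does (x ≟ u))
occursAt (x ∷ xs) (suc p) u = occursAt xs p u

∑-𝟙[x≟u]≡1 : ∀ {n} (x : Fin n) → ∑[ u < n ] 𝟙 (does (x ≟ u)) ≡ 1
∑-𝟙[x≟u]≡1 {suc n} Fin.zero    = cong suc (trans (∑-const n 0) (*-zeroʳ n))
∑-𝟙[x≟u]≡1 {suc n} (Fin.suc x) = ∑-𝟙[x≟u]≡1 x

∑-occursAt≤1 : ∀ {n} (xs : List (Fin n)) p → ∑[ u < n ] occursAt xs p u ≤ 1
∑-occursAt≤1 {n} []   p       = ≤-trans (≤-reflexive (trans (∑-const n 0) (*-zeroʳ n))) z≤n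
∑-occursAt≤1 (x ∷ xs) zero    = ≤-reflexive (∑-𝟙[x≟u]≡1 x)
∑-occursAt≤1 (x ∷ xs) (suc p) = ∑-occursAt≤1 xs p

occursAt-lookup : ∀ {n} (xs : List (Fin n)) i → occursAt xs (toℕ i) (lookup xs i) ≡ 1
occursAt-lookup (x ∷ xs) Fin.zero    = cong 𝟙 (dec-true (x ≟ x) refl)
occursAt-lookup (x ∷ xs) (Fin.suc i) = occursAt-lookup xs i

module _ {n} (xs : List (Fin n)) where

  occurrences : Fin n → ℕ
  occurrences v = ∑[ i < length xs ] occursAt xs (toℕ i) v

  ∑-occurrences≤length : ∑[ v < n ] occurrences v ≤ length xs
  ∑-occurrences≤length = begin
    ∑[ v < n ] ∑[ i < length xs ] occursAt xs (toℕ i) v  ≡⟨ ∑-comm {n} {length xs} (λ v i → occursAt xs (toℕ i) v) ⟩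
    ∑[ i < length xs ] ∑[ v < n ] occursAt xs (toℕ i) v  ≤⟨ ∑-mono-≤ {length xs} (∑-occursAt≤1 xs ∘ toℕ) ⟩
    ∑[ i < length xs ] 1                                 ≡⟨ ∑-const (length xs) 1 ⟩
    length xs * 1                                        ≡⟨ *-identityʳ (length xs) ⟩
    length xs                                            ∎
    where open ≤-Reasoning

  nearby : ℕ → ℕ → Fin n → ℕ
  nearby k a u = window k (λ p → occursAt xs p u) a

  ∑-nearby≤2k : ∀ k a → ∑[ u < n ] nearby k a u ≤ 2 * k
  ∑-nearby≤2k k a = begin
    ∑[ u < n ] ∑[ d < k ] (at (a + suc (toℕ d)) u + at (a ∸ suc (toℕ d)) u)
      ≡⟨ ∑-comm {n} {k} (λ u d → at (a + suc (toℕ d)) u + at (a ∸ suc (toℕ d)) u) ⟩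
    ∑[ d < k ] ∑[ u < n ] (at (a + suc (toℕ d)) u + at (a ∸ suc (toℕ d)) u)
      ≡⟨ sum-cong-≗ {k} (λ d → ∑-distrib-+ (at (a + suc (toℕ d))) (at (a ∸ suc (toℕ d)))) ⟩
    ∑[ d < k ] (∑[ u < n ] at (a + suc (toℕ d)) u + ∑[ u < n ] at (a ∸ suc (toℕ d)) u)
      ≤⟨ ∑-mono-≤ {k} (λ d → +-mono-≤ (∑-occursAt≤1 xs _) (∑-occursAt≤1 xs _)) ⟩
    ∑[ d < k ] 2
      ≡⟨ trans (∑-const k 2) (*-comm k 2) ⟩
    2 * k
      ∎
    where
    open ≤-Reasoning
    at = occursAt xs

module _ {k n} (G : Graph n) (xs : List (Fin n)) (xs-radius : IsRadiusSeq k G xs) where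

  closePairs : Fin n → Fin n → ℕ
  closePairs v u = ∑[ i < length xs ] (occursAt xs (toℕ i) v * nearby xs k (toℕ i) u)

  𝟙adj≤closePairs : ∀ v u → 𝟙 (adj G v u) ≤ closePairs v u
  𝟙adj≤closePairs v u with adj G v u in vu
  ... | false = z≤n
  ... | true with xs-radius v u vu
  ... | i , j , refl , refl , dist = begin
    1                                ≡⟨ sym (cong₂ _*_ (occursAt-lookup xs i) (occursAt-lookup xs j)) ⟩
    at (toℕ i) v * at (toℕ j) u      ≤⟨ *-monoʳ-≤ (at (toℕ i) v) (near⇒≤window (λ p → at p u) i≢j dist) ⟩
    at (toℕ i) v * nearby xs k (toℕ i) u
                                     ≤⟨ term≤∑ (λ i → at (toℕ i) v * nearby xs k (toℕ i) u) i ⟩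
    closePairs v u                   ∎
    where
    open ≤-Reasoning
    at = occursAt xs
    i≢j : toℕ i ≢ toℕ j
    i≢j i≡j with refl ← toℕ-injective i≡j with () ← trans (sym vu) (irrefl G v)

  deg≤2k*occurrences : ∀ v → deg G v ≤ 2 * k * occurrences xs v
  deg≤2k*occurrences v = begin
    deg G v
      ≡⟨ countᵇ-tabulate (adj G v) id ⟩
    ∑[ u < n ] 𝟙 (adj G v u)
      ≤⟨ ∑-mono-≤ {n} (𝟙adj≤closePairs v) ⟩
    ∑[ u < n ] ∑[ i < length xs ] (at i v * nearby xs k (toℕ i) u)
      ≡⟨ ∑-comm {n} {length xs} (λ u i → at i v * nearby xs k (toℕ i) u) ⟩
    ∑[ i < length xs ] ∑[ u < n ] (at i v * nearby xs k (toℕ i) u)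
      ≡⟨ sum-cong-≗ {length xs} (λ i → sym (*-distribˡ-sum {n} (at i v) (nearby xs k (toℕ i)))) ⟩
    ∑[ i < length xs ] (at i v * ∑[ u < n ] nearby xs k (toℕ i) u)
      ≤⟨ ∑-mono-≤ {length xs} (λ i → *-monoʳ-≤ (at i v) (∑-nearby≤2k xs k (toℕ i))) ⟩
    ∑[ i < length xs ] (at i v * (2 * k))
      ≡⟨ sum-cong-≗ {length xs} (λ i → *-comm (at i v) (2 * k)) ⟩
    ∑[ i < length xs ] (2 * k * at i v)
      ≡⟨ sym (*-distribˡ-sum {length xs} (2 * k) (λ i → at i v)) ⟩
    2 * k * occurrences xs v
      ∎
    where
    open ≤-Reasoning
    at : Fin (length xs) → Fin n → ℕ
    at i = occursAt xs (toℕ i)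

proposition3 : (k : ℕ) → .{{_ : NonZero k}} → (n : ℕ) → (G : Graph n) →
    (xs : List (Fin n)) → IsRadiusSeq k G xs →
    ΣV n (λ v → ⌈ deg G v / 2 * k ⌉ {{m*n≢0 2 k}}) ≤ length xs
proposition3 k n G xs xs-radius = begin
  ΣV n (λ v → ⌈ deg G v / 2 * k ⌉ {{m*n≢0 2 k}})
    ≡⟨ ΣV≡∑ n _ ⟩
  ∑[ v < n ] ⌈ deg G v / 2 * k ⌉ {{m*n≢0 2 k}}
    ≤⟨ ∑-mono-≤ {n} (λ v → ⌈m/n⌉≤o _ (2 * k) _ {{m*n≢0 2 k}} (deg≤2k*occurrences G xs xs-radius v)) ⟩
  ∑[ v < n ] occurrences xs v
    ≤⟨ ∑-occurrences≤length xs ⟩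
  length xs
    ∎
  where open ≤-Reasoning
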